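{- Let $\langle W,\leq,\mathbb{I},\mathbb{L},\mathbb{R}\rangle$ be any ternary frame with two relations (no further conditions assumed). Say a property involving formulae holds in the frame if it holds for all formulae and all valuations $v$. Then: (1) $\mathbb{LR}$-reverse holds iff for all $A,B$ and $v$, $v(A\otimes^{\mathsf{L}} B) = v(B\otimes^{\mathsf{R}} A)$ (validity of $\gamma$ and $\gamma^{ -1}$). (2) The following are equivalent: ($\alpha$) $v((A\otimes^{\mathsf{L}} B)\otimes^{\mathsf{L}} C)\subseteq v(A\otimes^{\mathsf{L}}(B\otimes^{\mathsf{L}} C))$ for all $A,B,C,v$; LSA holds; ($L$) $v(B\multimap^{\mathsf{L}} C)\subseteq v((A\multimap^{\mathsf{L}} B)\multimap^{\mathsf{L}}(A\multimap^{\mathsf{L}} C))$ for all $A,B,C,v$. Likewise the following are equivalent: ($\alpha^{\mathsf{R}}$) $v(A\otimes^{\mathsf{R}} (B\otimes^{\mathsf{R}} C))\subseteq v((A\otimes^{\mathsf{R}} B)\otimes^{\mathsf{R}} C)$ for all $A,B,C,v$; RSA holds; ($L^{\mathsf{R}}$) for all $A,B,C,D,v$, if $v(A)\subseteq v(B\multimap^{\mathsf{R}}(C\multimap^{\mathsf{R}} D))$ then there exists a formula $X$ with $v(A)\subseteq v(X\multimap^{\mathsf{R}} D)$ and $v(B)\subseteq v(C\multimap^{\mathsf{R}} X)$. (3) The following are equivalent: ($\lambda$) $v(\mathsf{I}\otimes^{\mathsf{L}} A)\subseteq v(A)$ for all $A,v$; LSLU holds; ($j$) $\mathbb{I}\subseteq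 v(A\multimap^{\mathsf{L}} A)$ for all $A,v$. Likewise the following are equivalent: ($\lambda^{\mathsf{R}}$) $v(A)\subseteq v(\mathsf{I}\otimes^{\mathsf{R}} A)$ for all $A,v$; RSLU holds; ($j^{\mathsf{R}}$) for all $A,B,v$, if $\mathbb{I}\subseteq v(A\multimap^{\mathsf{R}} B)$ then $v(A)\subseteq v(B)$. (4) The following are equivalent: ($\rho$) $v(A)\subseteq v(A\otimes^{\mathsf{L}}\mathsf{I})$ for all $A,v$; LSRU holds; ($i$) $v(\mathsf{I}\multimap^{\mathsf{L}} A)\subseteq v(A)$ for all $A,v$. Likewise the following are equivalent: ($\rho^{\mathsf{R}}$) $v(A\otimes^{\mathsf{R}}\mathsf{I})\subseteq v(A)$ for all $A,v$; RSRU holds; ($i^{\mathsf{R}}$) $v(A)\subseteq v(\mathsf{I}\multimap^{\mathsf{R}} A)$ for all $A,v$.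
   Context: Formulae are generated by $A,B ::= X \mid \mathsf{I} \mid A \otimes^{\mathsf{L}} B \mid A \multimap^{\mathsf{L}} B \mid A \otimes^{\mathsf{R}} B \mid A \multimap^{\mathsf{R}} B$, with $X$ ranging over a set of atoms. A ternary frame $\langle W,\leq,\mathbb{I},\mathbb{L},\mathbb{R}\rangle$ consists of a set $W$, a preorder $\le$ on $W$, a downward closed $\mathbb{I}\subseteq W$, and ternary relations $\mathbb{L},\mathbb{R}\subseteq W^3$ each upward closed in its first two arguments and downward closed in its third (if $\mathbb{L}abc$, $a\le a'$, $b\le b'$, $c'\le c$ then $\mathbb{L}a'b'c'$; same for $\mathbb{R}$). Conditions: ($\mathbb{LR}$-reverse) $\mathbb{L}abc\iff\mathbb{R}bac$ for all $a,b,c$. (LSA) for all $a,b,c,d,x$: $\mathbb{L}abx$ and $\mathbb{L}xcd$ imply $\exists y$, $\mathbb{L}bcy$ and $\mathbb{L}ayd$. (LSLU) for all $a,b\in W$, $e\in\mathbb{I}$: $\mathbb{L}eab$ implies $b\le a$. (LSRU) for all $a\in W$ there is $e\in \mathbb{I}$ with $\mathbb{L}aea$. (RSA) for all $a,b,c,d,x$: $\mathbb{R}bcx$ and $\mathbb{R}axd$ imply $\exists y$, $\mathbb{R}aby$ and $\mathbb{R}ycd$. (RSLU) for all $a\in W$ there is $e\in\mathbb{I}$ with $\mathbb{R}eaa$. (RSRU) for all $a,b\in W$, $e\in\mathbb{I}$: $\mathbb{R}aeb$ implies $b\le a$. A valuation is a map $v$ from formulae to downward closed subsets of $W$ (arbitrary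 on atoms) with $v(\mathsf{I})=\mathbb{I}$, $v(A\otimes^{\mathsf{L}} B) = \{c : \exists a\in v(A), b\in v(B), \mathbb{L}abc\}$, $v(A\multimap^{\mathsf{L}} B)=\{c : \forall a\in v(A), b\in W, \mathbb{L}cab \Rightarrow b\in v(B)\}$, $v(A\otimes^{\mathsf{R}} B) = \{c : \exists a\in v(A), b\in v(B), \mathbb{R}abc\}$, $v(A\multimap^{\mathsf{R}} B)=\{c : \forall a\in v(A), b\in W, \mathbb{R}cab \Rightarrow b\in v(B)\}$. -}

module Defs where

open import Level using (0ℓ)
open import Data.Nat using (ℕ)
open import Data.Product using (Σ; ∃; _×_; _,_)
open import Relation.Unary using (Pred; _⊆_; _≐_)
open import Function.Bundles using (_⇔_)

infixr 6 _⊗L_ _⊗R_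
infixr 5 _⊸L_ _⊸R_
data Fm : Set where
  at   : ℕ → Fm
  I    : Fm
  _⊗L_ : Fm → Fm → Fm
  _⊸L_ : Fm → Fm → Fm
  _⊗R_ : Fm → Fm → Fm
  _⊸R_ : Fm → Fm → Fm

record Frame : Set₁ where
  field
    W      : Set
    _≤_    : W → W → Set
    ≤-refl  : ∀ {a} → a ≤ a
    ≤-trans : ∀ {a b c} → a ≤ b → b ≤ c → a ≤ c
    𝕀      : Pred W 0ℓ
    𝕀-down : ∀ {a b} → b ≤ a → 𝕀 a → 𝕀 b
    𝕃      : W → W → W → Set
    ℝ      : W → W → W → Set
    𝕃-mono : ∀ {a b c a′ b′ c′} → 𝕃 a b c → a ≤ a′ → b ≤ b′ → c′ ≤ c → 𝕃 a′ b′ c′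
    ℝ-mono : ∀ {a b c a′ b′ c′} → ℝ a b c → a ≤ a′ → b ≤ b′ → c′ ≤ c → ℝ a′ b′ c′

module _ (F : Frame) where
  open Frame F

  DownClosed : Pred W 0ℓ → Set
  DownClosed P = ∀ {a b} → b ≤ a → P a → P b

  record Valuation : Set₁ where
    field
      val      : ℕ → Pred W 0ℓ
      val-down : ∀ n → DownClosed (val n)

  ⟦_⟧_ : Fm → Valuation → Pred W 0ℓ
  ⟦ at n ⟧ v = Valuation.val v n
  ⟦ I ⟧ v = 𝕀
  ⟦ A ⊗L B ⟧ v = λ c → ∃ λ a → ∃ λ b → (⟦ A ⟧ v) a × (⟦ B ⟧ v) b × 𝕃 a b c
  ⟦ A ⊸L B ⟧ v = λ c → ∀ a b → (⟦ A ⟧ v) a → 𝕃 c a b → (⟦ B ⟧ v) b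
  ⟦ A ⊗R B ⟧ v = λ c → ∃ λ a → ∃ λ b → (⟦ A ⟧ v) a × (⟦ B ⟧ v) b × ℝ a b c
  ⟦ A ⊸R B ⟧ v = λ c → ∀ a b → (⟦ A ⟧ v) a → ℝ c a b → (⟦ B ⟧ v) b

  LR-reverse : Set
  LR-reverse = ∀ a b c → (𝕃 a b c → ℝ b a c) × (ℝ b a c → 𝕃 a b c)

  LSA : Set
  LSA = ∀ a b c d x → 𝕃 a b x → 𝕃 x c d → ∃ λ y → 𝕃 b c y × 𝕃 a y d

  LSLU : Set
  LSLU = ∀ a b e → 𝕀 e → 𝕃 e a b → b ≤ a

  LSRU : Set
  LSRU = ∀ a → ∃ λ e → 𝕀 e × 𝕃 a e a

  RSA : Set
  RSA = ∀ a b c d x → ℝ b c x → ℝ a x d → ∃ λ y → ℝ a b y × ℝ y c d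

  RSLU : Set
  RSLU = ∀ a → ∃ λ e → 𝕀 e × ℝ e a a

  RSRU : Set
  RSRU = ∀ a b e → 𝕀 e → ℝ a e b → b ≤ a

  Valid-γ : Set₁
  Valid-γ = ∀ A B (v : Valuation) → (⟦ A ⊗L B ⟧ v) ≐ (⟦ B ⊗R A ⟧ v)

  Valid-α : Set₁
  Valid-α = ∀ A B C (v : Valuation) → (⟦ (A ⊗L B) ⊗L C ⟧ v) ⊆ (⟦ A ⊗L (B ⊗L C) ⟧ v)

  Valid-L : Set₁
  Valid-L = ∀ A B C (v : Valuation) → (⟦ B ⊸L C ⟧ v) ⊆ (⟦ (A ⊸L B) ⊸L (A ⊸L C) ⟧ v)

  Valid-αR : Set₁
  Valid-αR = ∀ A B C (v : Valuation) → (⟦ A ⊗R (B ⊗R C) ⟧ v) ⊆ (⟦ (A ⊗R B) ⊗R C ⟧ v)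

  Valid-LR : Set₁
  Valid-LR = ∀ A B C D (v : Valuation) → (⟦ A ⟧ v) ⊆ (⟦ B ⊸R (C ⊸R D) ⟧ v) →
             Σ Fm λ X → ((⟦ A ⟧ v) ⊆ (⟦ X ⊸R D ⟧ v)) × ((⟦ B ⟧ v) ⊆ (⟦ C ⊸R X ⟧ v))

  Valid-λ : Set₁
  Valid-λ = ∀ A (v : Valuation) → (⟦ I ⊗L A ⟧ v) ⊆ (⟦ A ⟧ v)

  Valid-j : Set₁
  Valid-j = ∀ A (v : Valuation) → 𝕀 ⊆ (⟦ A ⊸L A ⟧ v)

  Valid-λR : Set₁
  Valid-λR = ∀ A (v : Valuation) → (⟦ A ⟧ v) ⊆ (⟦ I ⊗R A ⟧ v)

  Valid-jR : Set₁
  Valid-jR = ∀ A B (v : Valuation) → 𝕀 ⊆ (⟦ A ⊸R B ⟧ v) → (⟦ A ⟧ v) ⊆ (⟦ B ⟧ v)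

  Valid-ρ : Set₁
  Valid-ρ = ∀ A (v : Valuation) → (⟦ A ⟧ v) ⊆ (⟦ A ⊗L I ⟧ v)

  Valid-i : Set₁
  Valid-i = ∀ A (v : Valuation) → (⟦ I ⊸L A ⟧ v) ⊆ (⟦ A ⟧ v)

  Valid-ρR : Set₁
  Valid-ρR = ∀ A (v : Valuation) → (⟦ A ⊗R I ⟧ v) ⊆ (⟦ A ⟧ v)

  Valid-iR : Set₁
  Valid-iR = ∀ A (v : Valuation) → (⟦ A ⟧ v) ⊆ (⟦ I ⊸R A ⟧ v)

{-# OPTIONS --safe #-}
module Submission where

-- Each frame condition implies the validity of its formulae by unfolding the
-- semantic clauses, using downward closure of denotations for the unit laws.
-- Conversely, the frame condition is read off from validity at a canonical
-- valuation: atoms denote principal downsets ↓a, except where the condition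
-- asserts an existence, in which case an atom denotes exactly the set of
-- worlds for which the required witness exists (e.g. for (L), the atom C
-- denotes {d | ∃ y. 𝕃 b c y × 𝕃 a y d}).

open import Defs
open import Level using (0ℓ)
open import Data.Nat using (ℕ; zero; suc)
open import Data.Product using (_×_; _,_; proj₁; proj₂; ∃)
open import Function using (const)
open import Function.Bundles using (_⇔_; mk⇔)
open import Relation.Unary using (Pred)

module Correspondence (F : Frame) where
  open Frame F

  infix 4 _⊩_
  _⊩_ : Valuation F → Fm → Pred W 0ℓ
  v ⊩ A = ⟦_⟧_ F A v

  ⊩-downClosed : ∀ A v → DownClosed F (v ⊩ A)
  ⊩-downClosed (at n)   v = Valuation.val-down v n
  ⊩-downClosed I        v = 𝕀-down
  ⊩-downClosed (A ⊗L B) v c′≤c (a , b , a∈A , b∈B , 𝕃abc) = a , b , a∈A , b∈B , 𝕃-mono 𝕃abc ≤-refl ≤-refl c′≤c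
  ⊩-downClosed (A ⊸L B) v c′≤c c∈A⊸B a b a∈A 𝕃c′ab = c∈A⊸B a b a∈A (𝕃-mono 𝕃c′ab c′≤c ≤-refl ≤-refl)
  ⊩-downClosed (A ⊗R B) v c′≤c (a , b , a∈A , b∈B , ℝabc) = a , b , a∈A , b∈B , ℝ-mono ℝabc ≤-refl ≤-refl c′≤c
  ⊩-downClosed (A ⊸R B) v c′≤c c∈A⊸B a b a∈A ℝc′ab = c∈A⊸B a b a∈A (ℝ-mono ℝc′ab c′≤c ≤-refl ≤-refl)

  record DownSet : Set₁ where
    field
      carrier    : Pred W 0ℓ
      downClosed : DownClosed F carrier
  open DownSet

  ↓_ : W → DownSet
  ↓ a = record { carrier = _≤ a ; downClosed = ≤-trans }

  𝕃⟨_,_⟩ : W → W → DownSet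
  𝕃⟨ a , b ⟩ = record { carrier = 𝕃 a b ; downClosed = λ c′≤c 𝕃abc → 𝕃-mono 𝕃abc ≤-refl ≤-refl c′≤c }

  ℝ⟨_,_⟩ : W → W → DownSet
  ℝ⟨ a , b ⟩ = record { carrier = ℝ a b ; downClosed = λ c′≤c ℝabc → ℝ-mono ℝabc ≤-refl ≤-refl c′≤c }

  ⋃ : Pred W 0ℓ → (W → DownSet) → DownSet
  ⋃ Q D = record
    { carrier    = λ w → ∃ λ x → Q x × carrier (D x) w
    ; downClosed = λ { w′≤w (x , x∈Q , w∈Dx) → x , x∈Q , downClosed (D x) w′≤w w∈Dx }
    }

  infixr 5 _∷_
  _∷_ : DownSet → (ℕ → DownSet) → ℕ → DownSet
  (P ∷ Ps) zero    = P
  (P ∷ Ps) (suc n) = Ps n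

  valuation : (ℕ → DownSet) → Valuation F
  valuation Ps = record { val = λ n → carrier (Ps n) ; val-down = λ n → downClosed (Ps n) }

  principal : W → Valuation F
  principal a = valuation (const (↓ a))

  LR-reverse⇒Valid-γ : LR-reverse F → Valid-γ F
  LR-reverse⇒Valid-γ rev A B v =
      (λ { (a , b , a∈A , b∈B , 𝕃abc) → b , a , b∈B , a∈A , proj₁ (rev a b _) 𝕃abc })
    , (λ { (b , a , b∈B , a∈A , ℝbac) → a , b , a∈A , b∈B , proj₂ (rev a b _) ℝbac })

  Valid-γ⇒LR-reverse : Valid-γ F → LR-reverse F
  Valid-γ⇒LR-reverse γ a b c = to , from
    where
    v : Valuation F
    v = valuation (↓ a ∷ const (↓ b))

    to : 𝕃 a b c → ℝ b a c
    to 𝕃abc =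
      let (b′ , a′ , b′≤b , a′≤a , ℝb′a′c) = proj₁ (γ (at 0) (at 1) v) (a , b , ≤-refl , ≤-refl , 𝕃abc)
      in ℝ-mono ℝb′a′c b′≤b a′≤a ≤-refl

    from : ℝ b a c → 𝕃 a b c
    from ℝbac =
      let (a′ , b′ , a′≤a , b′≤b , 𝕃a′b′c) = proj₂ (γ (at 0) (at 1) v) (b , a , ≤-refl , ≤-refl , ℝbac)
      in 𝕃-mono 𝕃a′b′c a′≤a b′≤b ≤-refl

  LSA⇒Valid-α : LSA F → Valid-α F
  LSA⇒Valid-α lsa A B C v (x , c , (a , b , a∈A , b∈B , 𝕃abx) , c∈C , 𝕃xcd) =
    let (y , 𝕃bcy , 𝕃ayd) = lsa a b c _ x 𝕃abx 𝕃xcd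
    in a , y , a∈A , (b , c , b∈B , c∈C , 𝕃bcy) , 𝕃ayd

  Valid-α⇒LSA : Valid-α F → LSA F
  Valid-α⇒LSA α a b c d x 𝕃abx 𝕃xcd =
    let (a′ , y , a′≤a , (b′ , c′ , b′≤b , c′≤c , 𝕃b′c′y) , 𝕃a′yd) =
          α (at 0) (at 1) (at 2) (valuation (↓ a ∷ ↓ b ∷ const (↓ c)))
            (x , c , (a , b , ≤-refl , ≤-refl , 𝕃abx) , ≤-refl , 𝕃xcd)
    in y , 𝕃-mono 𝕃b′c′y b′≤b c′≤c ≤-refl , 𝕃-mono 𝕃a′yd a′≤a ≤-refl ≤-refl

  LSA⇒Valid-L : LSA F → Valid-L F
  LSA⇒Valid-L lsa A B C v {c} c∈B⊸C x y x∈A⊸B 𝕃cxy a d a∈A 𝕃yad =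
    let (z , 𝕃xaz , 𝕃czd) = lsa c x a d y 𝕃cxy 𝕃yad
    in c∈B⊸C z d (x∈A⊸B a z a∈A 𝕃xaz) 𝕃czd

  Valid-L⇒LSA : Valid-L F → LSA F
  Valid-L⇒LSA L a b c d x 𝕃abx 𝕃xcd =
    L (at 0) (at 1) (at 2) v {a} a∈B⊸C b x b∈A⊸B 𝕃abx c d ≤-refl 𝕃xcd
    where
    v : Valuation F
    v = valuation (↓ c ∷ 𝕃⟨ b , c ⟩ ∷ const (⋃ (𝕃 b c) λ y → 𝕃⟨ a , y ⟩))

    a∈B⊸C : (v ⊩ at 1 ⊸L at 2) a
    a∈B⊸C y d′ 𝕃bcy 𝕃ayd′ = y , 𝕃bcy , 𝕃ayd′

    b∈A⊸B : (v ⊩ at 0 ⊸L at 1) b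
    b∈A⊸B c′ y c′≤c 𝕃bc′y = 𝕃-mono 𝕃bc′y ≤-refl c′≤c ≤-refl

  RSA⇒Valid-αR : RSA F → Valid-αR F
  RSA⇒Valid-αR rsa A B C v (a , x , a∈A , (b , c , b∈B , c∈C , ℝbcx) , ℝaxd) =
    let (y , ℝaby , ℝycd) = rsa a b c _ x ℝbcx ℝaxd
    in y , c , (a , b , a∈A , b∈B , ℝaby) , c∈C , ℝycd

  Valid-αR⇒RSA : Valid-αR F → RSA F
  Valid-αR⇒RSA α a b c d x ℝbcx ℝaxd =
    let (y , c′ , (a′ , b′ , a′≤a , b′≤b , ℝa′b′y) , c′≤c , ℝyc′d) =
          α (at 0) (at 1) (at 2) (valuation (↓ a ∷ ↓ b ∷ const (↓ c)))
            (a , x , ≤-refl , (b , c , ≤-refl , ≤-refl , ℝbcx) , ℝaxd)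
    in y , ℝ-mono ℝa′b′y a′≤a b′≤b ≤-refl , ℝ-mono ℝyc′d ≤-refl c′≤c ≤-refl

  RSA⇒Valid-LR : RSA F → Valid-LR F
  RSA⇒Valid-LR rsa A B C D v A⊆B⊸C⊸D = B ⊗R C , A⊆B⊗C⊸D , B⊆C⊸B⊗C
    where
    A⊆B⊗C⊸D : ∀ {a} → (v ⊩ A) a → (v ⊩ B ⊗R C ⊸R D) a
    A⊆B⊗C⊸D {a} a∈A x d (b , c , b∈B , c∈C , ℝbcx) ℝaxd =
      let (y , ℝaby , ℝycd) = rsa a b c d x ℝbcx ℝaxd
      in A⊆B⊸C⊸D a∈A b y b∈B ℝaby c d c∈C ℝycd

    B⊆C⊸B⊗C : ∀ {b} → (v ⊩ B) b → (v ⊩ C ⊸R B ⊗R C) b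
    B⊆C⊸B⊗C b∈B c x c∈C ℝbcx = _ , c , b∈B , c∈C , ℝbcx

  Valid-LR⇒RSA : Valid-LR F → RSA F
  Valid-LR⇒RSA LR a b c d x ℝbcx ℝaxd =
    let (X , A⊆X⊸D , B⊆C⊸X) = LR (at 0) (at 1) (at 2) (at 3) v A⊆B⊸C⊸D
    in A⊆X⊸D {a} ≤-refl x d (B⊆C⊸X {b} ≤-refl c x ≤-refl ℝbcx) ℝaxd
    where
    v : Valuation F
    v = valuation (↓ a ∷ ↓ b ∷ ↓ c ∷ const (⋃ (ℝ a b) λ y → ℝ⟨ y , c ⟩))

    A⊆B⊸C⊸D : ∀ {a′} → (v ⊩ at 0) a′ → (v ⊩ at 1 ⊸R at 2 ⊸R at 3) a′
    A⊆B⊸C⊸D a′≤a b′ y b′≤b ℝa′b′y c′ d′ c′≤c ℝyc′d′ =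
      y , ℝ-mono ℝa′b′y a′≤a b′≤b ≤-refl , ℝ-mono ℝyc′d′ ≤-refl c′≤c ≤-refl

  LSLU⇒Valid-λ : LSLU F → Valid-λ F
  LSLU⇒Valid-λ lslu A v (e , a , e∈𝕀 , a∈A , 𝕃eab) = ⊩-downClosed A v (lslu a _ e e∈𝕀 𝕃eab) a∈A

  Valid-λ⇒LSLU : Valid-λ F → LSLU F
  Valid-λ⇒LSLU λ-valid a b e e∈𝕀 𝕃eab = λ-valid (at 0) (principal a) (e , a , e∈𝕀 , ≤-refl , 𝕃eab)

  LSLU⇒Valid-j : LSLU F → Valid-j F
  LSLU⇒Valid-j lslu A v {e} e∈𝕀 a b a∈A 𝕃eab = ⊩-downClosed A v (lslu a b e e∈𝕀 𝕃eab) a∈A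

  Valid-j⇒LSLU : Valid-j F → LSLU F
  Valid-j⇒LSLU j a b e e∈𝕀 𝕃eab = j (at 0) (principal a) e∈𝕀 a b ≤-refl 𝕃eab

  RSLU⇒Valid-λR : RSLU F → Valid-λR F
  RSLU⇒Valid-λR rslu A v {a} a∈A =
    let (e , e∈𝕀 , ℝeaa) = rslu a in e , a , e∈𝕀 , a∈A , ℝeaa

  Valid-λR⇒RSLU : Valid-λR F → RSLU F
  Valid-λR⇒RSLU λR a =
    let (e , a′ , e∈𝕀 , a′≤a , ℝea′a) = λR (at 0) (principal a) {a} ≤-refl
    in e , e∈𝕀 , ℝ-mono ℝea′a ≤-refl a′≤a ≤-refl

  RSLU⇒Valid-jR : RSLU F → Valid-jR F
  RSLU⇒Valid-jR rslu A B v 𝕀⊆A⊸B {a} a∈A =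
    let (e , e∈𝕀 , ℝeaa) = rslu a in 𝕀⊆A⊸B e∈𝕀 a a a∈A ℝeaa

  Valid-jR⇒RSLU : Valid-jR F → RSLU F
  Valid-jR⇒RSLU jR a = jR (at 0) (at 1) v 𝕀⊆A⊸B {a} ≤-refl
    where
    v : Valuation F
    v = valuation (↓ a ∷ const (⋃ 𝕀 λ e → ℝ⟨ e , a ⟩))

    𝕀⊆A⊸B : ∀ {e} → 𝕀 e → (v ⊩ at 0 ⊸R at 1) e
    𝕀⊆A⊸B {e} e∈𝕀 a′ b a′≤a ℝea′b = e , e∈𝕀 , ℝ-mono ℝea′b ≤-refl a′≤a ≤-refl

  LSRU⇒Valid-ρ : LSRU F → Valid-ρ F
  LSRU⇒Valid-ρ lsru A v {a} a∈A =
    let (e , e∈𝕀 , 𝕃aea) = lsru a in a , e , a∈A , e∈𝕀 , 𝕃aea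

  Valid-ρ⇒LSRU : Valid-ρ F → LSRU F
  Valid-ρ⇒LSRU ρ a =
    let (a′ , e , a′≤a , e∈𝕀 , 𝕃a′ea) = ρ (at 0) (principal a) {a} ≤-refl
    in e , e∈𝕀 , 𝕃-mono 𝕃a′ea a′≤a ≤-refl ≤-refl

  LSRU⇒Valid-i : LSRU F → Valid-i F
  LSRU⇒Valid-i lsru A v {a} a∈I⊸A =
    let (e , e∈𝕀 , 𝕃aea) = lsru a in a∈I⊸A e a e∈𝕀 𝕃aea

  Valid-i⇒LSRU : Valid-i F → LSRU F
  Valid-i⇒LSRU i a = i (at 0) v {a} λ e b e∈𝕀 𝕃aeb → e , e∈𝕀 , 𝕃aeb
    where
    v : Valuation F
    v = valuation (const (⋃ 𝕀 λ e → 𝕃⟨ a , e ⟩))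

  RSRU⇒Valid-ρR : RSRU F → Valid-ρR F
  RSRU⇒Valid-ρR rsru A v (a , e , a∈A , e∈𝕀 , ℝaeb) = ⊩-downClosed A v (rsru a _ e e∈𝕀 ℝaeb) a∈A

  Valid-ρR⇒RSRU : Valid-ρR F → RSRU F
  Valid-ρR⇒RSRU ρR a b e e∈𝕀 ℝaeb = ρR (at 0) (principal a) (a , e , ≤-refl , e∈𝕀 , ℝaeb)

  RSRU⇒Valid-iR : RSRU F → Valid-iR F
  RSRU⇒Valid-iR rsru A v a∈A e b e∈𝕀 ℝaeb = ⊩-downClosed A v (rsru _ b e e∈𝕀 ℝaeb) a∈A

  Valid-iR⇒RSRU : Valid-iR F → RSRU F
  Valid-iR⇒RSRU iR a b e e∈𝕀 ℝaeb = iR (at 0) (principal a) {a} ≤-refl e b e∈𝕀 ℝaeb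

mainTheorem10 : (F : Frame) →
      (LR-reverse F ⇔ Valid-γ F)
    × ((Valid-α F ⇔ LSA F) × (LSA F ⇔ Valid-L F))
    × ((Valid-αR F ⇔ RSA F) × (RSA F ⇔ Valid-LR F))
    × ((Valid-λ F ⇔ LSLU F) × (LSLU F ⇔ Valid-j F))
    × ((Valid-λR F ⇔ RSLU F) × (RSLU F ⇔ Valid-jR F))
    × ((Valid-ρ F ⇔ LSRU F) × (LSRU F ⇔ Valid-i F))
    × ((Valid-ρR F ⇔ RSRU F) × (RSRU F ⇔ Valid-iR F))
mainTheorem10 F =
    mk⇔ LR-reverse⇒Valid-γ Valid-γ⇒LR-reverse
  , (mk⇔ Valid-α⇒LSA LSA⇒Valid-α , mk⇔ LSA⇒Valid-L Valid-L⇒LSA)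
  , (mk⇔ Valid-αR⇒RSA RSA⇒Valid-αR , mk⇔ RSA⇒Valid-LR Valid-LR⇒RSA)
  , (mk⇔ Valid-λ⇒LSLU LSLU⇒Valid-λ , mk⇔ LSLU⇒Valid-j Valid-j⇒LSLU)
  , (mk⇔ Valid-λR⇒RSLU RSLU⇒Valid-λR , mk⇔ RSLU⇒Valid-jR Valid-jR⇒RSLU)
  , (mk⇔ Valid-ρ⇒LSRU LSRU⇒Valid-ρ , mk⇔ LSRU⇒Valid-i Valid-i⇒LSRU)
  , (mk⇔ Valid-ρR⇒RSRU RSRU⇒Valid-ρR , mk⇔ RSRU⇒Valid-iR Valid-iR⇒RSRU)
  where open Correspondence F
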